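{- For any directed acyclic graph $G$ and integer $k\ge 0$, $$|\{A:A\text{ antichain of } G,\ d(A)\le k\}| \le 2^k\,|\{A:A\text{ maximal antichain of } G,\ d(A)\le k\}|.$$
   Context: The partial order $\preceq$ on $V(G)$ is reachability in $G$. An antichain is a set of pairwise incomparable elements; it is maximal if it is not strictly contained in another antichain. $\mathrm{pred}(A)=\{x:\exists a\in A,\ x\preceq a\}$, $\mathrm{comp}(A)=\{x:\exists a\in A,\ x\preceq a\text{ or }x\succeq a\}$. For a DAG $H$, $\min(H)$ is its set of minimal elements, and $G-S$ is the subgraph induced on $V(G)\setminus S$. The depth of an antichain is $d(A)=|\mathrm{pred}(A)|+|\min(G-\mathrm{comp}(A))|$. -}

module Defs where

open import Data.Nat using (ℕ; zero; suc; _+_)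
open import Data.Bool using (Bool; true; false; T)
open import Data.Fin using (Fin)
open import Data.Fin.Subset using (Subset; _∈_; _∉_; _⊂_; ∣_∣; inside; outside)
open import Data.Fin.Subset.Properties using (_∈?_; _⊂?_)
open import Data.Fin.Properties using (all?; any?)
open import Data.Vec using (Vec; []; _∷_; tabulate)
open import Data.Product using (Σ; ∃; _×_; _,_; proj₁; proj₂)
open import Data.Sum using (_⊎_)
open import Relation.Nullary using (¬_; Dec; yes; no; does)
open import Relation.Nullary.Decidable using (_×-dec_; _⊎-dec_; _→-dec_; ¬?; map′)
open import Relation.Binary.PropositionalEquality using (_≡_)
open import Relation.Binary.Construct.Closure.ReflexiveTransitive using (Star)
open import Relation.Binary.Construct.Closure.Transitive using (TransClosure)
open import Data.Fin.Properties using (_≟_)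

-- Finite directed graphs on vertex set Fin n, given by a Boolean
-- adjacency matrix:  Edge G x y  means there is an arc x → y.

Graph : ℕ → Set
Graph n = Fin n → Fin n → Bool

Edge : ∀ {n} → Graph n → Fin n → Fin n → Set
Edge G x y = T (G x y)

Acyclic : ∀ {n} → Graph n → Set
Acyclic {n} G = (x : Fin n) → ¬ TransClosure (Edge G) x x

_⊢_⪯_ : ∀ {n} → Graph n → Fin n → Fin n → Set
G ⊢ x ⪯ y = Star (Edge G) x y

-- A decision procedure for reachability (any one; all agree on 'does').
ReachDec : ∀ {n} → Graph n → Set
ReachDec {n} G = (x y : Fin n) → Dec (G ⊢ x ⪯ y)

Antichain : ∀ {n} → Graph n → Subset n → Set
Antichain {n} G A =
  (x y : Fin n) → x ∈ A → y ∈ A → G ⊢ x ⪯ y → x ≡ y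

MaximalAntichain : ∀ {n} → Graph n → Subset n → Set
MaximalAntichain {n} G A =
  Antichain G A × ¬ (Σ (Subset n) λ B → Antichain G B × A ⊂ B)

InPred : ∀ {n} → Graph n → Subset n → Fin n → Set
InPred {n} G A x = Σ (Fin n) λ a → a ∈ A × G ⊢ x ⪯ a

InComp : ∀ {n} → Graph n → Subset n → Fin n → Set
InComp {n} G A x = Σ (Fin n) λ a → a ∈ A × (G ⊢ x ⪯ a ⊎ G ⊢ a ⪯ x)

-- min(G - S): vertices of the induced subgraph G - S with no in-arc from
-- another vertex of G - S (the minimal elements of the DAG G - S).
InMinMinus : ∀ {n} → Graph n → (Fin n → Set) → Fin n → Set
InMinMinus {n} G S x =
  ¬ S x × ((y : Fin n) → ¬ S y → ¬ Edge G y x)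

private
  edge? : ∀ {n} (G : Graph n) (x y : Fin n) → Dec (Edge G x y)
  edge? G x y with G x y
  ... | true  = yes _
  ... | false = no (λ ())

  allSub? : ∀ {n} {P : Subset n → Set} → ((A : Subset n) → Dec (P A)) →
            Dec ((A : Subset n) → P A)
  allSub? {zero} {P} P? with P? []
  ... | yes p = yes λ { [] → p }
  ... | no ¬p = no λ f → ¬p (f [])
  allSub? {suc n} {P} P?
    with allSub? {n} {λ A → P (inside ∷ A)} (λ A → P? (inside ∷ A))
       | allSub? {n} {λ A → P (outside ∷ A)} (λ A → P? (outside ∷ A))
  ... | yes f | yes g = yes λ { (true ∷ A) → f A ; (false ∷ A) → g A }
  ... | no ¬f | _     = no λ h → ¬f (λ A → h (inside ∷ A))
  ... | yes _ | no ¬g = no λ h → ¬g (λ A → h (outside ∷ A))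

  anySub? : ∀ {m} {Q : Subset m → Set} → ((A : Subset m) → Dec (Q A)) →
            Dec (Σ (Subset m) Q)
  anySub? {zero} Q? with Q? []
  ... | yes q = yes ([] , q)
  ... | no ¬q = no λ { ([] , q) → ¬q q }
  anySub? {suc m} {Q} Q?
    with anySub? {m} {λ A → Q (inside ∷ A)} (λ A → Q? (inside ∷ A))
       | anySub? {m} {λ A → Q (outside ∷ A)} (λ A → Q? (outside ∷ A))
  ... | yes (A , q) | _ = yes (inside ∷ A , q)
  ... | no _ | yes (A , q) = yes (outside ∷ A , q)
  ... | no ¬l | no ¬r = no λ { (true ∷ A , q) → ¬l (A , q)
                              ; (false ∷ A , q) → ¬r (A , q) }

module _ {n : ℕ} (G : Graph n) (reach? : ReachDec G) where

  antichain? : (A : Subset n) → Dec (Antichain G A)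
  antichain? A =
    all? λ x → all? λ y → (x ∈? A) →-dec ((y ∈? A) →-dec
      (reach? x y →-dec (x ≟ y)))

  maximalAntichain? : (A : Subset n) → Dec (MaximalAntichain G A)
  maximalAntichain? A =
    antichain? A ×-dec ¬? (anySub? λ B → antichain? B ×-dec (A ⊂? B))

  inPred? : (A : Subset n) (x : Fin n) → Dec (InPred G A x)
  inPred? A x = any? λ a → (a ∈? A) ×-dec reach? x a

  inComp? : (A : Subset n) (x : Fin n) → Dec (InComp G A x)
  inComp? A x = any? λ a → (a ∈? A) ×-dec (reach? x a ⊎-dec reach? a x)

  inMinMinusComp? : (A : Subset n) (x : Fin n) →
                    Dec (InMinMinus G (InComp G A) x)
  inMinMinusComp? A x =
    ¬? (inComp? A x) ×-dec
      all? λ y → ¬? (inComp? A y) →-dec ¬? (edge? G y x)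

  predSet : Subset n → Subset n
  predSet A = tabulate λ x → does (inPred? A x)

  minMinusCompSet : Subset n → Subset n
  minMinusCompSet A = tabulate λ x → does (inMinMinusComp? A x)

  depth : Subset n → ℕ
  depth A = ∣ predSet A ∣ + ∣ minMinusCompSet A ∣

countSubsets : ∀ {n} {P : Subset n → Set} → ((A : Subset n) → Dec (P A)) → ℕ
countSubsets {zero} P? with P? []
... | yes _ = 1
... | no _  = 0
countSubsets {suc n} P? =
  countSubsets (λ A → P? (inside ∷ A)) + countSubsets (λ A → P? (outside ∷ A))

-- Adding to an antichain A the minimal elements of G − comp(A) yields a maximal antichain
-- A′ ⊇ A with d(A′) ≤ d(A): pred(A′) ⊆ pred(A) ∪ min(G − comp(A)), while comp(A′) is
-- everything, so min(G − comp(A′)) is empty.  A maximal antichain M with d(M) ≤ k has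
-- |M| ≤ |pred(M)| ≤ k, hence at most 2^k subsets; double counting the pairs A ⊆ M,
-- with M maximal of depth ≤ k, gives the bound.
module Submission where

open import Defs
open import Data.Nat using (ℕ; zero; suc; _+_; _*_; _^_; _≤_; z≤n; s≤s)
open import Data.Nat.Properties
  using (module ≤-Reasoning; _≤?_; ≤-refl; ≤-reflexive; ≤-trans; ≤-antisym; n≤0⇒n≡0;
         +-mono-≤; +-monoʳ-≤; +-suc; +-identityʳ; *-identityʳ; *-distribˡ-+; m≤m+n; m≤n+m; n≤1+n;
         ^-monoʳ-≤; +-commutativeSemigroup)
open import Data.Nat.Induction using (<-wellFounded)
open import Algebra.Properties.CommutativeSemigroup +-commutativeSemigroup using (interchange)
open import Data.Bool using (true; false; T?)
open import Data.Fin using (Fin)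
open import Data.Fin.Subset using (Subset; _∈_; _⊆_; _⊂_; ∣_∣; inside; outside; _∪_; ⊥)
open import Data.Fin.Subset.Properties
  using (_⊆?_; out⊆-⇔; in⊆in-⇔; p⊆p∪q; x∈p∪q⁻; x∈p∪q⁺;
         p⊆q⇒∣p∣≤∣q∣; p⊂q⇒∣p∣<∣q∣; ∣⊥∣≡0)
open import Data.Fin.Properties using (any?)
open import Data.Vec using ([]; _∷_; tabulate; here)
open import Data.Vec.Properties using ([]=⇒lookup; lookup⇒[]=; lookup∘tabulate)
open import Data.Product using (∃; _×_; _,_; proj₁; proj₂)
open import Data.Sum using (inj₁; inj₂)
open import Data.Empty using (⊥-elim)
open import Function using (_∘_; case_of_; _⇔_; Equivalence)
open import Induction.WellFounded using (WellFounded; Acc; acc; module Subrelation)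
import Relation.Binary.Construct.On as On
open import Relation.Nullary using (¬_; Dec; yes; no; does)
open import Relation.Nullary.Decidable using (dec-true; _×-dec_; ¬?)
open import Relation.Unary using (Decidable)
open import Relation.Binary.PropositionalEquality
  using (_≡_; refl; sym; trans; cong; cong₂; subst; module ≡-Reasoning)
open import Relation.Binary.Construct.Closure.ReflexiveTransitive using (ε; _◅_; _◅◅_)
open import Relation.Binary.Construct.Closure.Transitive using (TransClosure; [_]; _∷_)

sumSubsets : ∀ {n} → (Subset n → ℕ) → ℕ
sumSubsets {zero}  f = f []
sumSubsets {suc n} f = sumSubsets (f ∘ (inside ∷_)) + sumSubsets (f ∘ (outside ∷_))

indicator : ∀ {p} {P : Set p} → Dec P → ℕ
indicator (yes _) = 1
indicator (no _)  = 0

indicator-yes : ∀ {p} {P : Set p} (P? : Dec P) → P → indicator P? ≡ 1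
indicator-yes (yes _) _ = refl
indicator-yes (no ¬p) p = ⊥-elim (¬p p)

sumSubsets-mono : ∀ {n} {f g : Subset n → ℕ} → (∀ A → f A ≤ g A) → sumSubsets f ≤ sumSubsets g
sumSubsets-mono {zero}  f≤g = f≤g []
sumSubsets-mono {suc n} f≤g =
  +-mono-≤ (sumSubsets-mono (f≤g ∘ (inside ∷_))) (sumSubsets-mono (f≤g ∘ (outside ∷_)))

sumSubsets-cong : ∀ {n} {f g : Subset n → ℕ} → (∀ A → f A ≡ g A) → sumSubsets f ≡ sumSubsets g
sumSubsets-cong {zero}  f≡g = f≡g []
sumSubsets-cong {suc n} f≡g =
  cong₂ _+_ (sumSubsets-cong (f≡g ∘ (inside ∷_))) (sumSubsets-cong (f≡g ∘ (outside ∷_)))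

sumSubsets-+ : ∀ {n} (f g : Subset n → ℕ) → sumSubsets (λ A → f A + g A) ≡ sumSubsets f + sumSubsets g
sumSubsets-+ {zero}  f g = refl
sumSubsets-+ {suc n} f g =
  trans (cong₂ _+_ (sumSubsets-+ (f ∘ (inside ∷_)) (g ∘ (inside ∷_)))
                   (sumSubsets-+ (f ∘ (outside ∷_)) (g ∘ (outside ∷_))))
        (interchange (sumSubsets (f ∘ (inside ∷_))) (sumSubsets (g ∘ (inside ∷_))) _ _)

sumSubsets-*ˡ : ∀ {n} (c : ℕ) (f : Subset n → ℕ) → sumSubsets (λ A → c * f A) ≡ c * sumSubsets f
sumSubsets-*ˡ {zero}  c f = refl
sumSubsets-*ˡ {suc n} c f =
  trans (cong₂ _+_ (sumSubsets-*ˡ c (f ∘ (inside ∷_))) (sumSubsets-*ˡ c (f ∘ (outside ∷_))))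
        (sym (*-distribˡ-+ c _ _))

term≤sumSubsets : ∀ {n} (f : Subset n → ℕ) (A : Subset n) → f A ≤ sumSubsets f
term≤sumSubsets {zero}  f []          = ≤-refl
term≤sumSubsets {suc n} f (true  ∷ A) = ≤-trans (term≤sumSubsets (f ∘ (inside ∷_)) A) (m≤m+n _ _)
term≤sumSubsets {suc n} f (false ∷ A) = ≤-trans (term≤sumSubsets (f ∘ (outside ∷_)) A) (m≤n+m _ _)

sumSubsets-comm : ∀ {m n} (g : Subset m → Subset n → ℕ) →
  sumSubsets (λ A → sumSubsets (g A)) ≡ sumSubsets (λ B → sumSubsets (λ A → g A B))
sumSubsets-comm {zero}  g = refl
sumSubsets-comm {suc m} g =
  trans (cong₂ _+_ (sumSubsets-comm (g ∘ (inside ∷_))) (sumSubsets-comm (g ∘ (outside ∷_))))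
        (sym (sumSubsets-+ (λ B → sumSubsets (λ A → g (inside ∷ A) B))
                           (λ B → sumSubsets (λ A → g (outside ∷ A) B))))

countSubsets≡sumSubsets-indicator : ∀ {n} {P : Subset n → Set} (P? : Decidable P) →
                                    countSubsets P? ≡ sumSubsets (indicator ∘ P?)
countSubsets≡sumSubsets-indicator {zero} P? with P? []
... | yes _ = refl
... | no _  = refl
countSubsets≡sumSubsets-indicator {suc n} P? =
  cong₂ _+_ (countSubsets≡sumSubsets-indicator (P? ∘ (inside ∷_)))
            (countSubsets≡sumSubsets-indicator (P? ∘ (outside ∷_)))

countSubsets-mono : ∀ {n} {P Q : Subset n → Set} (P? : Decidable P) (Q? : Decidable Q) →
                    (∀ A → P A → Q A) → countSubsets P? ≤ countSubsets Q?
countSubsets-mono {zero} P? Q? P⇒Q with P? [] | Q? []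
... | no _  | _      = z≤n
... | yes _ | yes _  = ≤-refl
... | yes p | no ¬q  = ⊥-elim (¬q (P⇒Q [] p))
countSubsets-mono {suc n} P? Q? P⇒Q =
  +-mono-≤ (countSubsets-mono (P? ∘ (inside ∷_)) (Q? ∘ (inside ∷_)) (P⇒Q ∘ (inside ∷_)))
           (countSubsets-mono (P? ∘ (outside ∷_)) (Q? ∘ (outside ∷_)) (P⇒Q ∘ (outside ∷_)))

countSubsets-cong : ∀ {n} {P Q : Subset n → Set} (P? : Decidable P) (Q? : Decidable Q) →
                    (∀ A → P A ⇔ Q A) → countSubsets P? ≡ countSubsets Q?
countSubsets-cong P? Q? P⇔Q = ≤-antisym
  (countSubsets-mono P? Q? (Equivalence.to ∘ P⇔Q))
  (countSubsets-mono Q? P? (Equivalence.from ∘ P⇔Q))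

countSubsets-empty : ∀ {n} {P : Subset n → Set} (P? : Decidable P) → (∀ A → ¬ P A) →
                     countSubsets P? ≡ 0
countSubsets-empty {zero} P? ¬P with P? []
... | yes p = ⊥-elim (¬P [] p)
... | no _  = refl
countSubsets-empty {suc n} P? ¬P =
  cong₂ _+_ (countSubsets-empty (P? ∘ (inside ∷_)) (¬P ∘ (inside ∷_)))
            (countSubsets-empty (P? ∘ (outside ∷_)) (¬P ∘ (outside ∷_)))

countSubsets-⊆ : ∀ {n} (M : Subset n) → countSubsets (_⊆? M) ≡ 2 ^ ∣ M ∣
countSubsets-⊆ [] = refl
countSubsets-⊆ (true ∷ M) = begin
  countSubsets (λ A → inside ∷ A ⊆? inside ∷ M) + countSubsets (λ A → outside ∷ A ⊆? inside ∷ M)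
    ≡⟨ cong₂ _+_ (sym (countSubsets-cong (_⊆? M) _ (λ _ → in⊆in-⇔)))
                 (sym (countSubsets-cong (_⊆? M) _ (λ _ → out⊆-⇔))) ⟩
  countSubsets (_⊆? M) + countSubsets (_⊆? M)
    ≡⟨ cong (λ c → c + c) (countSubsets-⊆ M) ⟩
  2 ^ ∣ M ∣ + 2 ^ ∣ M ∣
    ≡⟨ cong (2 ^ ∣ M ∣ +_) (sym (+-identityʳ _)) ⟩
  2 ^ suc ∣ M ∣ ∎
  where open ≡-Reasoning
countSubsets-⊆ (false ∷ M) =
  cong₂ _+_ (countSubsets-empty (λ A → inside ∷ A ⊆? outside ∷ M) (λ _ ⊆out → case ⊆out here of λ ()))
            (trans (sym (countSubsets-cong (_⊆? M) _ (λ _ → out⊆-⇔))) (countSubsets-⊆ M))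

countSubsets-≤-covering : ∀ {n} {P Q : Subset n → Set} (P? : Decidable P) (Q? : Decidable Q) (k : ℕ) →
  (∀ A → P A → ∃ λ M → Q M × A ⊆ M) → (∀ M → Q M → ∣ M ∣ ≤ k) →
  countSubsets P? ≤ 2 ^ k * countSubsets Q?
countSubsets-≤-covering P? Q? k covered small = begin
  countSubsets P?                                      ≡⟨ countSubsets≡sumSubsets-indicator P? ⟩
  sumSubsets (indicator ∘ P?)                          ≤⟨ sumSubsets-mono covered-bound ⟩
  sumSubsets (λ A → sumSubsets (λ M → χQ M * χ⊆ A M))  ≡⟨ sumSubsets-comm (λ A M → χQ M * χ⊆ A M) ⟩
  sumSubsets (λ M → sumSubsets (λ A → χQ M * χ⊆ A M))  ≡⟨ sumSubsets-cong subsets-of ⟩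
  sumSubsets (λ M → χQ M * 2 ^ ∣ M ∣)                  ≤⟨ sumSubsets-mono small-bound ⟩
  sumSubsets (λ M → 2 ^ k * χQ M)                      ≡⟨ sumSubsets-*ˡ (2 ^ k) χQ ⟩
  2 ^ k * sumSubsets χQ
    ≡⟨ cong (2 ^ k *_) (sym (countSubsets≡sumSubsets-indicator Q?)) ⟩
  2 ^ k * countSubsets Q?                              ∎
  where
  open ≤-Reasoning

  χQ : Subset _ → ℕ
  χQ M = indicator (Q? M)

  χ⊆ : Subset _ → Subset _ → ℕ
  χ⊆ A M = indicator (A ⊆? M)

  covered-bound : ∀ A → indicator (P? A) ≤ sumSubsets (λ M → χQ M * χ⊆ A M)
  covered-bound A with P? A
  ... | no _  = z≤n
  ... | yes p with covered A p
  ...   | M , q , A⊆M = ≤-trans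
    (≤-reflexive (sym (cong₂ _*_ (indicator-yes (Q? M) q) (indicator-yes (A ⊆? M) A⊆M))))
    (term≤sumSubsets (λ M → χQ M * χ⊆ A M) M)

  subsets-of : ∀ M → sumSubsets (λ A → χQ M * χ⊆ A M) ≡ χQ M * 2 ^ ∣ M ∣
  subsets-of M = begin-equality
    sumSubsets (λ A → χQ M * χ⊆ A M)  ≡⟨ sumSubsets-*ˡ (χQ M) (λ A → χ⊆ A M) ⟩
    χQ M * sumSubsets (λ A → χ⊆ A M)  ≡⟨ cong (χQ M *_) (sym (countSubsets≡sumSubsets-indicator (_⊆? M))) ⟩
    χQ M * countSubsets (_⊆? M)       ≡⟨ cong (χQ M *_) (countSubsets-⊆ M) ⟩
    χQ M * 2 ^ ∣ M ∣                  ∎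

  small-bound : ∀ M → χQ M * 2 ^ ∣ M ∣ ≤ 2 ^ k * χQ M
  small-bound M with Q? M
  ... | no _  = z≤n
  ... | yes q = begin
    1 * 2 ^ ∣ M ∣  ≡⟨ +-identityʳ _ ⟩
    2 ^ ∣ M ∣      ≤⟨ ^-monoʳ-≤ 2 (small M q) ⟩
    2 ^ k          ≡⟨ sym (*-identityʳ _) ⟩
    2 ^ k * 1 ∎

∈-tabulate-does⁻ : ∀ {n} {P : Fin n → Set} (P? : Decidable P) {x} → x ∈ tabulate (does ∘ P?) → P x
∈-tabulate-does⁻ P? {x} x∈ with P? x | trans (sym (lookup∘tabulate (does ∘ P?) x)) ([]=⇒lookup x∈)
... | yes p | _ = p
... | no _  | ()

∈-tabulate-does⁺ : ∀ {n} {P : Fin n → Set} (P? : Decidable P) {x} → P x → x ∈ tabulate (does ∘ P?)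
∈-tabulate-does⁺ P? {x} p = lookup⇒[]= x _ (trans (lookup∘tabulate (does ∘ P?) x) (dec-true (P? x) p))

∣p∪q∣≤∣p∣+∣q∣ : ∀ {n} (p q : Subset n) → ∣ p ∪ q ∣ ≤ ∣ p ∣ + ∣ q ∣
∣p∪q∣≤∣p∣+∣q∣ []          []          = z≤n
∣p∪q∣≤∣p∣+∣q∣ (true  ∷ p) (true  ∷ q) =
  s≤s (≤-trans (∣p∪q∣≤∣p∣+∣q∣ p q) (+-monoʳ-≤ ∣ p ∣ (n≤1+n _)))
∣p∪q∣≤∣p∣+∣q∣ (true  ∷ p) (false ∷ q) = s≤s (∣p∪q∣≤∣p∣+∣q∣ p q)
∣p∪q∣≤∣p∣+∣q∣ (false ∷ p) (true  ∷ q) =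
  subst (suc ∣ p ∪ q ∣ ≤_) (sym (+-suc ∣ p ∣ ∣ q ∣)) (s≤s (∣p∪q∣≤∣p∣+∣q∣ p q))
∣p∪q∣≤∣p∣+∣q∣ (false ∷ p) (false ∷ q) = ∣p∪q∣≤∣p∣+∣q∣ p q

module _ {n : ℕ} (G : Graph n) (reach? : ReachDec G) where

  edge? : (x y : Fin n) → Dec (Edge G x y)
  edge? x y = T? (G x y)

  edge◅⪯⇒⁺ : ∀ {x y z} → Edge G x y → G ⊢ y ⪯ z → TransClosure (Edge G) x z
  edge◅⪯⇒⁺ x→y ε             = [ x→y ]
  edge◅⪯⇒⁺ x→y (y→y′ ◅ y′⪯z) = x→y ∷ edge◅⪯⇒⁺ y→y′ y′⪯z

  ancestors : Fin n → Subset n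
  ancestors x = tabulate (does ∘ λ z → reach? z x)

  edge⇒ancestors⊂ : Acyclic G → ∀ {x y} → Edge G y x → ancestors y ⊂ ancestors x
  edge⇒ancestors⊂ acyclic {x} {y} y→x =
      (λ z∈ → ∈-tabulate-does⁺ (λ w → reach? w x) (∈-tabulate-does⁻ (λ w → reach? w y) z∈ ◅◅ y→x ◅ ε))
    , x , ∈-tabulate-does⁺ (λ w → reach? w x) ε
    , λ x∈ → acyclic y (edge◅⪯⇒⁺ y→x (∈-tabulate-does⁻ (λ w → reach? w y) x∈))

  edge-wellFounded : Acyclic G → WellFounded (Edge G)
  edge-wellFounded acyclic = Subrelation.wellFounded (p⊂q⇒∣p∣<∣q∣ ∘ edge⇒ancestors⊂ acyclic)
                               (On.wellFounded (∣_∣ ∘ ancestors) <-wellFounded)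

  minimal-below : Acyclic G → {S : Fin n → Set} → Decidable S → ∀ {x} → ¬ S x →
                  ∃ λ m → InMinMinus G S m × G ⊢ m ⪯ x
  minimal-below acyclic {S} S? {x} x∉S = descend x∉S (edge-wellFounded acyclic x)
    where
    descend : ∀ {x} → ¬ S x → Acc (Edge G) x → ∃ λ m → InMinMinus G S m × G ⊢ m ⪯ x
    descend {x} x∉S (acc below) with any? (λ y → ¬? (S? y) ×-dec edge? y x)
    ... | no noneBelow = x , (x∉S , λ y y∉S y→x → noneBelow (y , y∉S , y→x)) , ε
    ... | yes (y , y∉S , y→x) with descend y∉S (below y→x)
    ...   | m , m-min , m⪯y = m , m-min , m⪯y ◅◅ y→x ◅ ε

  ∉comp-between : ∀ {A x y z} → ¬ InComp G A x → Edge G x z → G ⊢ z ⪯ y → ¬ InComp G A y →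
                  ¬ InComp G A z
  ∉comp-between x∉ x→z z⪯y y∉ (a , a∈A , inj₁ z⪯a) = x∉ (a , a∈A , inj₁ (x→z ◅ z⪯a))
  ∉comp-between x∉ x→z z⪯y y∉ (a , a∈A , inj₂ a⪯z) = y∉ (a , a∈A , inj₂ (a⪯z ◅◅ z⪯y))

  ∉comp-⪯-minimal⇒≡ : ∀ {A x y} → ¬ InComp G A x → InMinMinus G (InComp G A) y → G ⊢ x ⪯ y → x ≡ y
  ∉comp-⪯-minimal⇒≡ x∉ y-min ε = refl
  ∉comp-⪯-minimal⇒≡ {x = x} x∉ y-min (x→z ◅ z⪯y)
    with ∉comp-⪯-minimal⇒≡ (∉comp-between x∉ x→z z⪯y (proj₁ y-min)) y-min z⪯y
  ... | refl = ⊥-elim (proj₂ y-min x x∉ x→z)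

  ∈predSet⁻ : ∀ {A x} → x ∈ predSet G reach? A → InPred G A x
  ∈predSet⁻ {A} = ∈-tabulate-does⁻ (inPred? G reach? A)

  ∈predSet⁺ : ∀ {A x} → InPred G A x → x ∈ predSet G reach? A
  ∈predSet⁺ {A} = ∈-tabulate-does⁺ (inPred? G reach? A)

  ∈minMinusCompSet⁻ : ∀ {A x} → x ∈ minMinusCompSet G reach? A → InMinMinus G (InComp G A) x
  ∈minMinusCompSet⁻ {A} = ∈-tabulate-does⁻ (inMinMinusComp? G reach? A)

  ∈minMinusCompSet⁺ : ∀ {A x} → InMinMinus G (InComp G A) x → x ∈ minMinusCompSet G reach? A
  ∈minMinusCompSet⁺ {A} = ∈-tabulate-does⁺ (inMinMinusComp? G reach? A)

  ∣p∣≤depth : ∀ M → ∣ M ∣ ≤ depth G reach? M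
  ∣p∣≤depth M = ≤-trans (p⊆q⇒∣p∣≤∣q∣ (λ {x} x∈M → ∈predSet⁺ (x , x∈M , ε))) (m≤m+n _ _)

  comparable⇒maximal : ∀ {M} → Antichain G M → (∀ x → InComp G M x) → MaximalAntichain G M
  comparable⇒maximal {M} M-antichain comparable = M-antichain , λ where
    (B , B-antichain , M⊆B , x , x∈B , x∉M) → case comparable x of λ where
      (a , a∈M , inj₁ x⪯a) → x∉M (subst (_∈ M) (sym (B-antichain x a x∈B (M⊆B a∈M) x⪯a)) a∈M)
      (a , a∈M , inj₂ a⪯x) → x∉M (subst (_∈ M) (B-antichain a x (M⊆B a∈M) x∈B a⪯x) a∈M)

  comparable⇒minMinusComp-empty : ∀ {M} → (∀ x → InComp G M x) → ∣ minMinusCompSet G reach? M ∣ ≡ 0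
  comparable⇒minMinusComp-empty {M} comparable = n≤0⇒n≡0 (begin
    ∣ minMinusCompSet G reach? M ∣  ≤⟨ p⊆q⇒∣p∣≤∣q∣ nothing-minimal ⟩
    ∣ ⊥ {n = n} ∣                   ≡⟨ ∣⊥∣≡0 n ⟩
    0                               ∎)
    where
    open ≤-Reasoning
    nothing-minimal : minMinusCompSet G reach? M ⊆ ⊥
    nothing-minimal x∈ = ⊥-elim (proj₁ (∈minMinusCompSet⁻ x∈) (comparable _))

  extend : Subset n → Subset n
  extend A = A ∪ minMinusCompSet G reach? A

  extend-antichain : ∀ {A} → Antichain G A → Antichain G (extend A)
  extend-antichain {A} A-antichain x y x∈ y∈ x⪯y
    with x∈p∪q⁻ A (minMinusCompSet G reach? A) x∈ | x∈p∪q⁻ A (minMinusCompSet G reach? A) y∈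
  ... | inj₁ x∈A | inj₁ y∈A = A-antichain x y x∈A y∈A x⪯y
  ... | inj₁ x∈A | inj₂ y∈m = ⊥-elim (proj₁ (∈minMinusCompSet⁻ y∈m) (x , x∈A , inj₂ x⪯y))
  ... | inj₂ x∈m | inj₁ y∈A = ⊥-elim (proj₁ (∈minMinusCompSet⁻ x∈m) (y , y∈A , inj₁ x⪯y))
  ... | inj₂ x∈m | inj₂ y∈m =
    ∉comp-⪯-minimal⇒≡ (proj₁ (∈minMinusCompSet⁻ x∈m)) (∈minMinusCompSet⁻ y∈m) x⪯y

  extend-comparable : Acyclic G → ∀ A x → InComp G (extend A) x
  extend-comparable acyclic A x with inComp? G reach? A x
  ... | yes (a , a∈A , a~x) = a , x∈p∪q⁺ (inj₁ a∈A) , a~x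
  ... | no x∉comp with minimal-below acyclic (inComp? G reach? A) x∉comp
  ...   | m , m-min , m⪯x = m , x∈p∪q⁺ {p = A} (inj₂ (∈minMinusCompSet⁺ m-min)) , inj₂ m⪯x

  extend-maximal : Acyclic G → ∀ {A} → Antichain G A → MaximalAntichain G (extend A)
  extend-maximal acyclic {A} A-antichain =
    comparable⇒maximal (extend-antichain A-antichain) (extend-comparable acyclic A)

  predSet-extend : ∀ A → predSet G reach? (extend A) ⊆ predSet G reach? A ∪ minMinusCompSet G reach? A
  predSet-extend A {z} z∈ with ∈predSet⁻ z∈
  ... | a , a∈ , z⪯a with x∈p∪q⁻ A (minMinusCompSet G reach? A) a∈
  ...   | inj₁ a∈A = x∈p∪q⁺ (inj₁ (∈predSet⁺ (a , a∈A , z⪯a)))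
  ...   | inj₂ a∈m with inComp? G reach? A z
  ...     | yes (b , b∈A , inj₁ z⪯b) = x∈p∪q⁺ (inj₁ (∈predSet⁺ (b , b∈A , z⪯b)))
  ...     | yes (b , b∈A , inj₂ b⪯z) =
    ⊥-elim (proj₁ (∈minMinusCompSet⁻ a∈m) (b , b∈A , inj₂ (b⪯z ◅◅ z⪯a)))
  ...     | no z∉comp = x∈p∪q⁺ {p = predSet G reach? A} (inj₂ (subst (_∈ _) (sym z≡a) a∈m))
    where
    z≡a : z ≡ a
    z≡a = ∉comp-⪯-minimal⇒≡ z∉comp (∈minMinusCompSet⁻ a∈m) z⪯a

  depth-extend : Acyclic G → ∀ A → depth G reach? (extend A) ≤ depth G reach? A
  depth-extend acyclic A = begin
    ∣ predSet G reach? (extend A) ∣ + ∣ minMinusCompSet G reach? (extend A) ∣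
      ≡⟨ cong (∣ predSet G reach? (extend A) ∣ +_)
              (comparable⇒minMinusComp-empty (extend-comparable acyclic A)) ⟩
    ∣ predSet G reach? (extend A) ∣ + 0
      ≡⟨ +-identityʳ _ ⟩
    ∣ predSet G reach? (extend A) ∣
      ≤⟨ p⊆q⇒∣p∣≤∣q∣ (predSet-extend A) ⟩
    ∣ predSet G reach? A ∪ minMinusCompSet G reach? A ∣
      ≤⟨ ∣p∪q∣≤∣p∣+∣q∣ (predSet G reach? A) (minMinusCompSet G reach? A) ⟩
    depth G reach? A ∎
    where open ≤-Reasoning

corollary20 : ∀ {n} (G : Graph n) → Acyclic G → (reach? : ReachDec G) → (k : ℕ) →
    countSubsets (λ (A : Subset n) → antichain? G reach? A ×-dec (depth G reach? A ≤? k))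
      ≤ 2 ^ k * countSubsets (λ (A : Subset n) → maximalAntichain? G reach? A ×-dec (depth G reach? A ≤? k))
corollary20 G acyclic reach? k = countSubsets-≤-covering
  (λ A → antichain? G reach? A ×-dec (depth G reach? A ≤? k))
  (λ A → maximalAntichain? G reach? A ×-dec (depth G reach? A ≤? k)) k
  (λ A (A-antichain , dA≤k) → extend G reach? A
    , (extend-maximal G reach? acyclic A-antichain , ≤-trans (depth-extend G reach? acyclic A) dA≤k)
    , p⊆p∪q _)
  (λ M (_ , dM≤k) → ≤-trans (∣p∣≤depth G reach? M) dM≤k)
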